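{- The generating series $H_{\mathrm{gr}}(z) := \sum_{h\ge0}\#\mathcal{D}^*(\mathfrak{l}_h)\,z^h$ satisfies $$H_{\mathrm{gr}} = 1 + z\,H_{\mathrm{gr}} + z\,(H_{\mathrm{gr}}\boxtimes H_{\mathrm{gr}}).$$
   Context: A duplicative forest is a finite word of duplicative trees (empty word $\epsilon$ allowed); a duplicative tree is $\circ(\mathfrak{g})$ or $\bullet(\mathfrak{g})$ for a duplicative forest $\mathfrak{g}$; $\cdot$ is concatenation. $\mathfrak{f}\lessdot\mathfrak{f}'$ iff $\mathfrak{f}'$ is obtained from $\mathfrak{f}$ by replacing one subtree $\circ(\mathfrak{g})$ by $\bullet(\mathfrak{g}\cdot\mathfrak{g})$; $\ll$ is its reflexive transitive closure; $\mathcal{D}^*(\mathfrak{f}) := \{\mathfrak{f}' : \mathfrak{f}\ll\mathfrak{f}'\}$. The ladders are $\mathfrak{l}_0:=\epsilon$ and $\mathfrak{l}_h:=\circ(\mathfrak{l}_{h-1})$. (By the paper's isomorphism results, $\#\mathcal{D}^*(\mathfrak{l}_h)$ is the cardinality of the Mockingbird lattice of order $h+1$.) The Hadamard product of power series is $(\sum_n a_nz^n)\boxtimes(\sum_n b_nz^n) := \sum_n a_nb_nz^n$. -}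

module Defs where

open import Data.Nat using (ℕ; zero; suc; _+_; _*_)
open import Data.List using (List; []; _∷_; _++_; length)
open import Data.List.Membership.Propositional using (_∈_)
open import Data.List.Relation.Unary.Unique.Propositional using (Unique)
open import Data.Product using (Σ; _×_)
open import Relation.Binary.PropositionalEquality using (_≡_)
open import Relation.Binary.Construct.Closure.ReflexiveTransitive using (Star)

data Tree : Set where
  white : List Tree → Tree
  black : List Tree → Tree

Forest : Set
Forest = List Tree

mutual
  data _⋖ₜ_ : Tree → Tree → Set where
    dup     : ∀ g → white g ⋖ₜ black (g ++ g)
    inWhite : ∀ {g g'} → g ⋖ g' → white g ⋖ₜ white g'
    inBlack : ∀ {g g'} → g ⋖ g' → black g ⋖ₜ black g'

  data _⋖_ : Forest → Forest → Set where
    here  : ∀ {t t' f} → t ⋖ₜ t' → (t ∷ f) ⋖ (t' ∷ f)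
    there : ∀ {t f f'} → f ⋖ f' → (t ∷ f) ⋖ (t ∷ f')

_≪_ : Forest → Forest → Set
_≪_ = Star _⋖_

D* : Forest → Forest → Set
D* f f' = f ≪ f'

ladder : ℕ → Forest
ladder zero    = []
ladder (suc h) = white (ladder h) ∷ []

HasCard : (Forest → Set) → ℕ → Set
HasCard P n = Σ (List Forest) λ L →
  Unique L × ((∀ x → x ∈ L → P x) × (∀ x → P x → x ∈ L)) × length L ≡ n

Series : Set
Series = ℕ → ℕ

oneS : Series
oneS zero    = 1
oneS (suc _) = 0

zS : Series → Series
zS s zero    = 0
zS s (suc n) = s n

_⊕_ : Series → Series → Series
(s ⊕ t) n = s n + t n

_⊠_ : Series → Series → Series
(s ⊠ t) n = s n * t n

_≈S_ : Series → Series → Set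
s ≈S t = ∀ n → s n ≡ t n

{-# OPTIONS --safe #-}
-- A forest reachable from the ladder 𝔩ₕ₊₁ = ∘(𝔩ₕ) is a single tree, and the trees
-- reachable from ∘(𝔩ₕ) are, by induction on h: ∘(ε) and •(ε) for h = 0, and for
-- h + 1 the trees ∘(a) and •(a · b) with a, b reachable from ∘(𝔩ₕ).  Indeed, a move
-- at the root of ∘(a) duplicates a into •(a · a), and below a black root the two
-- subtrees then evolve independently.  Hence the counts satisfy
-- H₀ = 1 and Hₕ₊₁ = Hₕ + Hₕ², which is the coefficientwise form of the equation.
module Submission where

open import Defs
open import Data.Nat using (ℕ; zero; suc; _+_; _*_)
open import Data.Product using (Σ; _×_; _,_)
open import Data.Sum using (inj₁; inj₂)
open import Data.List using (List; []; _∷_; [_]; _++_; length; map; cartesianProductWith)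
open import Data.List.Properties using (length-map; length-++)
open import Data.List.Membership.Propositional using (_∈_)
open import Data.List.Membership.Propositional.Properties
  using (∈-map⁻; ∈-map⁺; ∈-++⁻; ∈-++⁺ˡ; ∈-++⁺ʳ; ∈-cartesianProductWith⁻; ∈-cartesianProductWith⁺)
open import Data.List.Relation.Unary.Any using (here; there)
open import Data.List.Relation.Unary.All using ([]; _∷_)
open import Data.List.Relation.Unary.AllPairs using ([]; _∷_)
open import Data.List.Relation.Unary.Unique.Propositional using (Unique)
open import Data.List.Relation.Binary.Disjoint.Propositional using (Disjoint)
open import Data.List.Relation.Unary.Unique.Propositional.Properties
  using (map⁺; ++⁺; cartesianProductWith⁺)
open import Relation.Binary.Core using (Rel)
open import Relation.Binary.Definitions using (_Respects_)
open import Relation.Binary.PropositionalEquality using (_≡_; refl; trans; cong₂; module ≡-Reasoning)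
open import Relation.Binary.Construct.Closure.ReflexiveTransitive
  using (Star; ε; _◅_; _◅◅_; gmap)

Hgr : Series
Hgr zero    = 1
Hgr (suc n) = Hgr n + Hgr n * Hgr n

Hgr-equation : Hgr ≈S ((oneS ⊕ zS Hgr) ⊕ zS (Hgr ⊠ Hgr))
Hgr-equation zero    = refl
Hgr-equation (suc n) = refl

length-cartesianProductWith : ∀ {a b c} {A : Set a} {B : Set b} {C : Set c} (f : A → B → C) xs ys →
  length (cartesianProductWith f xs ys) ≡ length xs * length ys
length-cartesianProductWith f []       ys = refl
length-cartesianProductWith f (x ∷ xs) ys =
  trans (length-++ (map (f x) ys))
        (cong₂ _+_ (length-map (f x) ys) (length-cartesianProductWith f xs ys))

Star-respects : ∀ {a ℓ p} {A : Set a} {R : Rel A ℓ} {P : A → Set p} → P Respects R → P Respects Star R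
Star-respects step ε        p = p
Star-respects step (r ◅ rs) p = Star-respects step rs (step r p)

_≪ₜ_ : Tree → Tree → Set
_≪ₜ_ = Star _⋖ₜ_

white₁ : Tree → Tree
white₁ a = white [ a ]

black₂ : Tree → Tree → Tree
black₂ a b = black (a ∷ b ∷ [])

data Descendant : ℕ → Tree → Set where
  white-leaf : Descendant 0 (white [])
  black-leaf : Descendant 0 (black [])
  grow       : ∀ {h a} → Descendant h a → Descendant (suc h) (white₁ a)
  split      : ∀ {h a b} → Descendant h a → Descendant h b → Descendant (suc h) (black₂ a b)

Descendant-respects-⋖ₜ : ∀ {h} → Descendant h Respects _⋖ₜ_
Descendant-respects-⋖ₜ (dup [])                   white-leaf  = black-leaf
Descendant-respects-⋖ₜ (dup _)                    (grow d)    = split d d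
Descendant-respects-⋖ₜ (inWhite (here r))         (grow d)    = grow (Descendant-respects-⋖ₜ r d)
Descendant-respects-⋖ₜ (inBlack (here r))         (split d e) = split (Descendant-respects-⋖ₜ r d) e
Descendant-respects-⋖ₜ (inBlack (there (here r))) (split d e) = split d (Descendant-respects-⋖ₜ r e)

Descendant-reachable : ∀ {h t} → Descendant h t → white (ladder h) ≪ₜ t
Descendant-reachable white-leaf  = ε
Descendant-reachable black-leaf  = dup [] ◅ ε
Descendant-reachable (grow d)    = gmap white₁ (λ r → inWhite (here r)) (Descendant-reachable d)
Descendant-reachable (split {a = a} d e) =
  dup _ ◅ (gmap (λ x → black₂ x _) (λ r → inBlack (here r)) (Descendant-reachable d)
       ◅◅ gmap (black₂ a) (λ r → inBlack (there (here r))) (Descendant-reachable e))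

descendants : ℕ → List Tree
descendants zero    = white [] ∷ black [] ∷ []
descendants (suc h) = map white₁ (descendants h) ++ cartesianProductWith black₂ (descendants h) (descendants h)

∈-descendants⁺ : ∀ {h t} → Descendant h t → t ∈ descendants h
∈-descendants⁺ white-leaf  = here refl
∈-descendants⁺ black-leaf  = there (here refl)
∈-descendants⁺ (grow d)    = ∈-++⁺ˡ (∈-map⁺ white₁ (∈-descendants⁺ d))
∈-descendants⁺ (split d e) =
  ∈-++⁺ʳ _ (∈-cartesianProductWith⁺ black₂ (∈-descendants⁺ d) (∈-descendants⁺ e))

∈-descendants⁻ : ∀ h {t} → t ∈ descendants h → Descendant h t
∈-descendants⁻ zero (here refl)         = white-leaf
∈-descendants⁻ zero (there (here refl)) = black-leaf
∈-descendants⁻ (suc h) p with ∈-++⁻ (map white₁ (descendants h)) p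
... | inj₁ q with ∈-map⁻ white₁ q
...   | a , a∈ , refl = grow (∈-descendants⁻ h a∈)
∈-descendants⁻ (suc h) p | inj₂ q with ∈-cartesianProductWith⁻ black₂ (descendants h) (descendants h) q
...   | a , b , a∈ , b∈ , refl = split (∈-descendants⁻ h a∈) (∈-descendants⁻ h b∈)

descendants-unique : ∀ h → Unique (descendants h)
descendants-unique zero    = ((λ ()) ∷ []) ∷ [] ∷ []
descendants-unique (suc h) =
  ++⁺ (map⁺ (λ { refl → refl }) (descendants-unique h))
      (cartesianProductWith⁺ black₂ (λ { refl → refl , refl }) (descendants-unique h) (descendants-unique h))
      roots-differ
  where
  roots-differ : Disjoint (map white₁ (descendants h)) (cartesianProductWith black₂ (descendants h) (descendants h))
  roots-differ (p , q) with ∈-map⁻ white₁ p | ∈-cartesianProductWith⁻ black₂ (descendants h) (descendants h) q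
  ... | _ , _ , refl | _ , _ , _ , _ , ()

length-descendants : ∀ h → length (descendants h) ≡ Hgr (suc h)
length-descendants zero    = refl
length-descendants (suc h) = begin
  length (map white₁ ds ++ cartesianProductWith black₂ ds ds)
    ≡⟨ length-++ (map white₁ ds) ⟩
  length (map white₁ ds) + length (cartesianProductWith black₂ ds ds)
    ≡⟨ cong₂ _+_ (length-map white₁ ds) (length-cartesianProductWith black₂ ds ds) ⟩
  length ds + length ds * length ds
    ≡⟨ cong₂ (λ m n → m + n * n) (length-descendants h) (length-descendants h) ⟩
  Hgr (suc h) + Hgr (suc h) * Hgr (suc h)
    ∎
  where
  open ≡-Reasoning
  ds : List Tree
  ds = descendants h

forests : ℕ → List Forest
forests zero    = [ [] ]
forests (suc h) = map [_] (descendants h)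

forests-unique : ∀ h → Unique (forests h)
forests-unique zero    = [] ∷ []
forests-unique (suc h) = map⁺ (λ { refl → refl }) (descendants-unique h)

length-forests : ∀ h → length (forests h) ≡ Hgr h
length-forests zero    = refl
length-forests (suc h) = trans (length-map [_] (descendants h)) (length-descendants h)

∈-forests-reachable : ∀ h {f} → f ∈ forests h → D* (ladder h) f
∈-forests-reachable zero    (here refl) = ε
∈-forests-reachable (suc h) p with ∈-map⁻ [_] p
... | t , t∈ , refl = gmap [_] here (Descendant-reachable (∈-descendants⁻ h t∈))

⋖-singleton : ∀ {t f} → [ t ] ⋖ f → Σ Tree λ t' → t ⋖ₜ t' × f ≡ [ t' ]
⋖-singleton (here r)   = _ , r , refl
⋖-singleton (there ())

∈-forests-respects-⋖ : ∀ h → (_∈ forests h) Respects _⋖_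
∈-forests-respects-⋖ zero    () (here refl)
∈-forests-respects-⋖ (suc h) r p with ∈-map⁻ [_] p
... | t , t∈ , refl with ⋖-singleton r
...   | t' , r' , refl = ∈-map⁺ [_] (∈-descendants⁺ (Descendant-respects-⋖ₜ r' (∈-descendants⁻ h t∈)))

ladder∈forests : ∀ h → ladder h ∈ forests h
ladder∈forests zero    = here refl
ladder∈forests (suc h) = ∈-map⁺ [_] (∈-descendants⁺ (white-ladder-descendant h))
  where
  white-ladder-descendant : ∀ h → Descendant h (white (ladder h))
  white-ladder-descendant zero    = white-leaf
  white-ladder-descendant (suc h) = grow (white-ladder-descendant h)

reachable-∈-forests : ∀ h {f} → D* (ladder h) f → f ∈ forests h
reachable-∈-forests h r = Star-respects (∈-forests-respects-⋖ h) r (ladder∈forests h)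

proposition3p4p3 : Σ (ℕ → ℕ) λ H →
    ((h : ℕ) → HasCard (D* (ladder h)) (H h)) ×
    (H ≈S ((oneS ⊕ zS H) ⊕ zS (H ⊠ H)))
proposition3p4p3 = Hgr , enumeration , Hgr-equation
  where
  enumeration : (h : ℕ) → HasCard (D* (ladder h)) (Hgr h)
  enumeration h =
    forests h , forests-unique h ,
    ((λ _ → ∈-forests-reachable h) , (λ _ → reachable-∈-forests h)) ,
    length-forests h
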